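{- Let $G$ be a connected graph. If every MNS ordering of $G$ is also a LexBFS ordering of $G$, then $G$ is $\{P_4, C_4\}$-free.
   Context: All graphs are finite and simple. For an ordering $\sigma$ of $V(G)$ write $x<_\sigma y$ if $x$ precedes $y$. In each of the following, the condition is required for all $a<_\sigma b<_\sigma c$ with $ac\in E(G)$ and $ab\notin E(G)$: $\sigma$ is a LexBFS ordering if there is $d$ with $d<_\sigma a$, $db\in E(G)$, $dc\notin E(G)$; an MNS ordering if there is $d$ with $d<_\sigma b$, $db\in E(G)$, $dc\notin E(G)$. $\{P_4,C_4\}$-free means no induced path on 4 vertices and no induced 4-cycle. -}

module Defs where

open import Data.Nat using (ℕ)
open import Data.Fin using (Fin; _<_)
open import Data.Bool using (Bool; true; false)
open import Data.Product using (Σ; ∃; _×_; _,_)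
open import Relation.Binary.PropositionalEquality using (_≡_)
open import Relation.Nullary using (¬_)
open import Function.Definitions using (Injective)

record Graph (n : ℕ) : Set where
  field
    adj    : Fin n → Fin n → Bool
    sym    : ∀ x y → adj x y ≡ adj y x
    irrefl : ∀ x → adj x x ≡ false

module _ {n : ℕ} (G : Graph n) where
  open Graph G

  Edge : Fin n → Fin n → Set
  Edge x y = adj x y ≡ true

  data Walk : Fin n → Fin n → Set where
    here : ∀ {x} → Walk x x
    step : ∀ {x y z} → Edge x y → Walk y z → Walk x z

  Connected : Set
  Connected = ∀ x y → Walk x y

  InducedP4 : Fin n → Fin n → Fin n → Fin n → Set
  InducedP4 a b c d =
    ¬ a ≡ b × ¬ a ≡ c × ¬ a ≡ d × ¬ b ≡ c × ¬ b ≡ d × ¬ c ≡ d ×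
    Edge a b × Edge b c × Edge c d ×
    ¬ Edge a c × ¬ Edge b d × ¬ Edge a d

  InducedC4 : Fin n → Fin n → Fin n → Fin n → Set
  InducedC4 a b c d =
    ¬ a ≡ b × ¬ a ≡ c × ¬ a ≡ d × ¬ b ≡ c × ¬ b ≡ d × ¬ c ≡ d ×
    Edge a b × Edge b c × Edge c d × Edge d a ×
    ¬ Edge a c × ¬ Edge b d

  P4C4Free : Set
  P4C4Free = ∀ a b c d → ¬ InducedP4 a b c d × ¬ InducedC4 a b c d

-- An ordering σ of V = Fin n, given by the (injective, hence bijective)
-- position map: x <σ y iff pos x < pos y.
Ordering : ℕ → Set
Ordering n = Σ (Fin n → Fin n) (Injective _≡_ _≡_)

_<[_]_ : ∀ {n} → Fin n → Ordering n → Fin n → Set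
x <[ (pos , _) ] y = pos x < pos y

module _ {n : ℕ} (G : Graph n) where

  IsLexBFS : Ordering n → Set
  IsLexBFS σ = ∀ a b c → a <[ σ ] b → b <[ σ ] c →
    Edge G a c → ¬ Edge G a b →
    ∃ λ d → d <[ σ ] a × Edge G d b × ¬ Edge G d c

  IsMNS : Ordering n → Set
  IsMNS σ = ∀ a b c → a <[ σ ] b → b <[ σ ] c →
    Edge G a c → ¬ Edge G a b →
    ∃ λ d → d <[ σ ] b × Edge G d b × ¬ Edge G d c

-- An induced P₄ or C₄ contains vertices z – x – w – y with xy and wz non-edges.
-- Start a maximal neighbourhood search with x, w and keep choosing a maximal
-- vertex whose visited neighbourhood contains that of y.  Every vertex chosen
-- while y is unvisited is adjacent to w, hence is not z; and y is not adjacent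
-- to x.  So some non-neighbour m of x is visited before z.  Completing the search
-- arbitrarily gives an MNS ordering with x < m < z, xz an edge and xm not, which
-- is not LexBFS since nothing precedes x.
{-# OPTIONS --safe #-}
module Submission where

open import Level using (Level)
open import Data.Nat using (ℕ; _≤_; _<_; z≤n; s≤s)
open import Data.Nat.Properties using (m≤n⇒m≤1+n; <-irrefl; <-asym; <⇒≱)
open import Data.Nat.Induction using (<-wellFounded)
open import Data.Fin using (Fin; toℕ; fromℕ<; _≟_)
open import Data.Fin.Properties using (toℕ-fromℕ<)
import Data.Fin.Properties as Fin
open import Data.Bool using (true)
import Data.Bool.Properties as Bool
open import Data.List using (List; []; _∷_; [_]; _++_; filter; length; allFin)
open import Data.List.Properties using (filter-notAll; length-tabulate)
open import Data.List.Membership.Propositional using (_∈_; _∉_; find)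
open import Data.List.Membership.Propositional.Properties using (∈-allFin; ∈-filter⁺; ∈-++⁻; ∈-++⁺ʳ)
open import Data.List.Relation.Unary.All as All using (All; []; _∷_; all?)
open import Data.List.Relation.Unary.All.Properties using (all-filter; ¬All⇒Any¬; ¬Any⇒All¬)
open import Data.List.Relation.Unary.Any as Any using (Any; here; there)
open import Data.List.Relation.Unary.Unique.Propositional using (Unique; []; _∷_)
open import Data.List.Extrema.Nat using (argmax; argmax-all; f[xs]≤f[argmax])
open import Data.Empty using (⊥)
open import Data.Product using (∃; ∃₂; _×_; _,_; proj₁; proj₂)
open import Data.Sum using (_⊎_; inj₁; inj₂; [_,_]′)
open import Function using (id; _∘_; const; flip)
open import Function.Definitions using (Injective)
open import Induction.WellFounded using (Acc; acc)
open import Relation.Nullary using (¬_; Dec; yes; no; contradiction)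
open import Relation.Nullary.Decidable using (_×-dec_; _→-dec_; decidable-stable)
open import Relation.Unary using (Pred; Decidable; _∩_; ∁)
open import Relation.Binary using (Rel; IsStrictTotalOrder; Trichotomous; tri<; tri≈; tri>)
open import Relation.Binary.PropositionalEquality
  using (_≡_; refl; sym; cong; subst; subst₂; isEquivalence; resp₂)
import Relation.Binary.PropositionalEquality as ≡
open import Defs

module _ {a p q : Level} {A : Set a} {P : Pred A p} {Q : Pred A q}
         (P? : Decidable P) (Q? : Decidable Q) where

  length-filter-mono : ∀ {xs} → All (λ x → P x → Q x) xs →
                       length (filter P? xs) ≤ length (filter Q? xs)
  length-filter-mono {[]}     []             = z≤n
  length-filter-mono {x ∷ xs} (px⇒qx ∷ P⇒Q) with P? x | Q? x
  ... | yes _  | yes _  = s≤s (length-filter-mono P⇒Q)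
  ... | yes px | no ¬qx = contradiction (px⇒qx px) ¬qx
  ... | no _   | yes _  = m≤n⇒m≤1+n (length-filter-mono P⇒Q)
  ... | no _   | no _   = length-filter-mono P⇒Q

  length-filter-< : ∀ {xs} → All (λ x → P x → Q x) xs → Any (Q ∩ ∁ P) xs →
                    length (filter P? xs) < length (filter Q? xs)
  length-filter-< {x ∷ xs} (_ ∷ P⇒Q) (here (qx , ¬px)) with P? x | Q? x
  ... | yes px | _      = contradiction px ¬px
  ... | no _   | yes _  = s≤s (length-filter-mono P⇒Q)
  ... | no _   | no ¬qx = contradiction qx ¬qx
  length-filter-< {x ∷ xs} (px⇒qx ∷ P⇒Q) (there any) with P? x | Q? x
  ... | yes _  | yes _  = s≤s (length-filter-< P⇒Q any)
  ... | yes px | no ¬qx = contradiction (px⇒qx px) ¬qx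
  ... | no _   | yes _  = m≤n⇒m≤1+n (length-filter-< P⇒Q any)
  ... | no _   | no _   = length-filter-< P⇒Q any

module OrderingOf {n : ℕ} {ℓ : Level} {_≺_ : Rel (Fin n) ℓ}
                  (≺-sto : IsStrictTotalOrder _≡_ _≺_) where
  open IsStrictTotalOrder ≺-sto

  rank : Fin n → ℕ
  rank y = length (filter (_<? y) (allFin n))

  rank-< : ∀ {x y} → x ≺ y → rank x < rank y
  rank-< {x} {y} x≺y =
    length-filter-< (_<? x) (_<? y) (All.universal (λ _ z≺x → trans z≺x x≺y) (allFin n))
      (Any.map (λ { refl → x≺y , irrefl refl }) (∈-allFin x))

  rank<n : ∀ y → rank y < n
  rank<n y = subst (rank y <_) (length-tabulate id)
    (filter-notAll (_<? y) (allFin n) (Any.map (λ { refl → irrefl refl }) (∈-allFin y)))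

  position : Fin n → Fin n
  position y = fromℕ< (rank<n y)

  position-< : ∀ {x y} → x ≺ y → toℕ (position x) < toℕ (position y)
  position-< {x} {y} x≺y =
    subst₂ _<_ (sym (toℕ-fromℕ< (rank<n x))) (sym (toℕ-fromℕ< (rank<n y))) (rank-< x≺y)

  position-injective : Injective _≡_ _≡_ position
  position-injective {x} {y} eq with compare x y
  ... | tri< x≺y _ _ = contradiction (position-< x≺y) (<-irrefl (cong toℕ eq))
  ... | tri≈ _ x≡y _ = x≡y
  ... | tri> _ _ y≺x = contradiction (position-< y≺x) (<-irrefl (cong toℕ (sym eq)))

  ordering : Ordering n
  ordering = position , position-injective

  ≺⇒<σ : ∀ {x y} → x ≺ y → x <[ ordering ] y
  ≺⇒<σ = position-<

  <σ⇒≺ : ∀ {x y} → x <[ ordering ] y → x ≺ y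
  <σ⇒≺ {x} {y} x<y with compare x y
  ... | tri< x≺y _ _  = x≺y
  ... | tri≈ _ refl _ = contradiction x<y (<-irrefl refl)
  ... | tri> _ _ y≺x  = contradiction x<y (<-asym (position-< y≺x))

module _ {a : Level} {A : Set a} where

  -- Visiting orders are lists with the most recently visited element first.
  infix 4 _≺[_]_
  data _≺[_]_ : A → List A → A → Set a where
    newest : ∀ {x m vs} → x ∈ vs → x ≺[ m ∷ vs ] m
    older  : ∀ {x y m vs} → x ≺[ vs ] y → x ≺[ m ∷ vs ] y

  ≺-∈ˡ : ∀ {x y vs} → x ≺[ vs ] y → x ∈ vs
  ≺-∈ˡ (newest x∈vs) = there x∈vs
  ≺-∈ˡ (older x≺y)   = there (≺-∈ˡ x≺y)

  ≺-[] : ∀ {x y z} → ¬ x ≺[ [ z ] ] y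
  ≺-[] (newest ())
  ≺-[] (older ())

  ≺-trans : ∀ {x y z vs} → Unique vs → x ≺[ vs ] y → y ≺[ vs ] z → x ≺[ vs ] z
  ≺-trans _             (newest x∈vs) (newest _)  = newest x∈vs
  ≺-trans _             (older x≺y)   (newest _)  = newest (≺-∈ˡ x≺y)
  ≺-trans (m∉vs ∷ _)    (newest _)    (older m≺z) = contradiction refl (All.lookup m∉vs (≺-∈ˡ m≺z))
  ≺-trans (_ ∷ vs-uniq) (older x≺y)   (older y≺z) = older (≺-trans vs-uniq x≺y y≺z)

  ≺-irrefl : ∀ {x vs} → Unique vs → ¬ x ≺[ vs ] x
  ≺-irrefl (m∉vs ∷ _)    (newest m∈vs) = contradiction refl (All.lookup m∉vs m∈vs)
  ≺-irrefl (_ ∷ vs-uniq) (older x≺x)   = ≺-irrefl vs-uniq x≺x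

  ≺-connex : ∀ {x y vs} → x ∈ vs → y ∈ vs → x ≺[ vs ] y ⊎ x ≡ y ⊎ y ≺[ vs ] x
  ≺-connex (here refl)  (here refl)  = inj₂ (inj₁ refl)
  ≺-connex (here refl)  (there y∈vs) = inj₂ (inj₂ (newest y∈vs))
  ≺-connex (there x∈vs) (here refl)  = inj₁ (newest x∈vs)
  ≺-connex (there x∈vs) (there y∈vs) with ≺-connex x∈vs y∈vs
  ... | inj₁ x≺y        = inj₁ (older x≺y)
  ... | inj₂ (inj₁ x≡y) = inj₂ (inj₁ x≡y)
  ... | inj₂ (inj₂ y≺x) = inj₂ (inj₂ (older y≺x))

  ≺-isStrictTotalOrder : ∀ {vs} → Unique vs → (∀ x → x ∈ vs) →
                         IsStrictTotalOrder _≡_ _≺[ vs ]_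
  ≺-isStrictTotalOrder {vs} vs-uniq all∈vs = record
    { isStrictPartialOrder = record
      { isEquivalence = isEquivalence
      ; irrefl        = λ { refl → ≺-irrefl vs-uniq }
      ; trans         = ≺-trans vs-uniq
      ; <-resp-≈      = resp₂ _≺[ vs ]_
      }
    ; compare = compare
    }
    where
    ≺-asym : ∀ {x y} → x ≺[ vs ] y → ¬ y ≺[ vs ] x
    ≺-asym x≺y y≺x = ≺-irrefl vs-uniq (≺-trans vs-uniq x≺y y≺x)

    compare : Trichotomous _≡_ _≺[ vs ]_
    compare x y with ≺-connex (all∈vs x) (all∈vs y)
    ... | inj₁ x≺y         = tri< x≺y (λ { refl → ≺-irrefl vs-uniq x≺y }) (≺-asym x≺y)
    ... | inj₂ (inj₁ refl) = tri≈ (≺-irrefl vs-uniq) refl (≺-irrefl vs-uniq)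
    ... | inj₂ (inj₂ y≺x)  = tri> (≺-asym y≺x) (λ { refl → ≺-irrefl vs-uniq y≺x }) y≺x

  ≺-++⁺ʳ : ∀ ws {x y vs} → x ≺[ vs ] y → x ≺[ ws ++ vs ] y
  ≺-++⁺ʳ []       x≺y = x≺y
  ≺-++⁺ʳ (_ ∷ ws) x≺y = older (≺-++⁺ʳ ws x≺y)

  ≺-++-new : ∀ {ws x y vs} → x ∈ vs → y ∈ ws → x ≺[ ws ++ vs ] y
  ≺-++-new {_ ∷ ws} x∈vs (here refl)  = newest (∈-++⁺ʳ ws x∈vs)
  ≺-++-new {_ ∷ ws} x∈vs (there y∈ws) = older (≺-++-new x∈vs y∈ws)

  ≺-++⁻ʳ : ∀ ws {x y vs} → Unique (ws ++ vs) → y ∈ vs → x ≺[ ws ++ vs ] y → x ≺[ vs ] y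
  ≺-++⁻ʳ []       _               _    x≺y         = x≺y
  ≺-++⁻ʳ (_ ∷ ws) (m∉rest ∷ _)    m∈vs (newest _)  =
    contradiction refl (All.lookup m∉rest (∈-++⁺ʳ ws m∈vs))
  ≺-++⁻ʳ (_ ∷ ws) (_ ∷ rest-uniq) y∈vs (older x≺y) = ≺-++⁻ʳ ws rest-uniq y∈vs x≺y

module _ {n : ℕ} (G : Graph n) where
  open Graph G using (adj; irrefl)
  open import Data.List.Membership.DecPropositional (_≟_ {n}) using (_∈?_; _∉?_)

  E : Fin n → Fin n → Set
  E = Edge G

  E? : ∀ x y → Dec (E x y)
  E? x y = adj x y Bool.≟ true

  E-sym : ∀ {x y} → E x y → E y x
  E-sym {x} {y} exy = ≡.trans (Graph.sym G y x) exy

  E-irrefl : ∀ {x y} → E x y → ¬ x ≡ y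
  E-irrefl {x} exy refl = contradiction (≡.trans (sym (irrefl x)) exy) λ ()

  _⊆N[_]_ : Fin n → List (Fin n) → Fin n → Set
  u ⊆N[ vs ] v = All (λ a → E a u → E a v) vs

  _⊆N[_]?_ : ∀ u vs v → Dec (u ⊆N[ vs ] v)
  u ⊆N[ vs ]? v = all? (λ a → E? a u →-dec E? a v) vs

  ⊆N-refl : ∀ {u} vs → u ⊆N[ vs ] u
  ⊆N-refl vs = All.universal (λ _ → id) vs

  ⊆N-trans : ∀ {u v w vs} → u ⊆N[ vs ] v → v ⊆N[ vs ] w → u ⊆N[ vs ] w
  ⊆N-trans u⊆v v⊆w = All.zipWith (λ (u⇒v , v⇒w) → v⇒w ∘ u⇒v) (u⊆v , v⊆w)

  -- The constructive form of: no unvisited vertex has a visited neighbourhood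
  -- strictly larger than that of m.
  MaximalNbhd : List (Fin n) → Fin n → Set
  MaximalNbhd vs m = ∀ {a c} → a ∈ vs → c ∉ vs → E a c → ¬ E a m →
                     ∃ λ d → d ∈ vs × E d m × ¬ E d c

  data MNSSearch : List (Fin n) → Set where
    []    : MNSSearch []
    visit : ∀ {m vs} → m ∉ vs → MaximalNbhd vs m → MNSSearch vs → MNSSearch (m ∷ vs)

  search-unique : ∀ {vs} → MNSSearch vs → Unique vs
  search-unique []               = []
  search-unique (visit m∉vs _ S) = ¬Any⇒All¬ _ m∉vs ∷ search-unique S

  Later : List (Fin n) → Fin n → Fin n → Set
  Later vs b c = b ≺[ vs ] c ⊎ c ∉ vs

  Later-older : ∀ {m vs b c} → m ∉ vs → Later (m ∷ vs) b c → Later vs b c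
  Later-older m∉vs (inj₁ (newest _))  = inj₂ m∉vs
  Later-older m∉vs (inj₁ (older b≺c)) = inj₁ b≺c
  Later-older m∉vs (inj₂ c∉m∷vs)      = inj₂ (c∉m∷vs ∘ there)

  Later-newest : ∀ {m vs c} → m ∉ vs → Later (m ∷ vs) m c → c ∉ vs
  Later-newest m∉vs m≤c = [ (λ m≺c → contradiction (≺-∈ˡ m≺c) m∉vs) , id ]′ (Later-older m∉vs m≤c)

  search-mns : ∀ {vs a b c} → MNSSearch vs → a ≺[ vs ] b → Later vs b c → E a c → ¬ E a b →
               ∃ λ d → d ≺[ vs ] b × E d b × ¬ E d c
  search-mns (visit m∉vs m-max _) (newest a∈vs) m≤c eac ¬eam
    with d , d∈vs , edm , ¬edc ← m-max a∈vs (Later-newest m∉vs m≤c) eac ¬eam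
    = d , newest d∈vs , edm , ¬edc
  search-mns (visit m∉vs _ S) (older a≺b) b≤c eac ¬eab
    with d , d≺b , edb , ¬edc ← search-mns S a≺b (Later-older m∉vs b≤c) eac ¬eab
    = d , older d≺b , edb , ¬edc

  nbhdSize : List (Fin n) → Fin n → ℕ
  nbhdSize vs u = length (filter (λ a → E? a u) vs)

  choose : ∀ vs {v} → v ∉ vs → ∃ λ m → m ∉ vs × v ⊆N[ vs ] m × MaximalNbhd vs m
  choose vs {v} v∉vs = m , proj₁ m-candidate , proj₂ m-candidate , m-maximal
    where
    Candidate : Fin n → Set
    Candidate u = u ∉ vs × v ⊆N[ vs ] u

    candidate? : Decidable Candidate
    candidate? u = (u ∉? vs) ×-dec (v ⊆N[ vs ]? u)

    candidates : List (Fin n)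
    candidates = filter candidate? (allFin n)

    m : Fin n
    m = argmax (nbhdSize vs) v candidates

    m-candidate : Candidate m
    m-candidate = argmax-all (nbhdSize vs) (v∉vs , ⊆N-refl vs) (all-filter candidate? (allFin n))

    m-largest : ∀ {c} → Candidate c → nbhdSize vs c ≤ nbhdSize vs m
    m-largest {c} c-candidate =
      All.lookup (f[xs]≤f[argmax] v candidates) (∈-filter⁺ candidate? (∈-allFin c) c-candidate)

    m-maximal : MaximalNbhd vs m
    m-maximal {a} {c} a∈vs c∉vs eac ¬eam with m ⊆N[ vs ]? c
    ... | yes m⊆c = contradiction (m-largest (c∉vs , ⊆N-trans (proj₂ m-candidate) m⊆c)) (<⇒≱ m<c)
      where
      m<c : nbhdSize vs m < nbhdSize vs c
      m<c = length-filter-< (λ d → E? d m) (λ d → E? d c) m⊆c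
              (Any.map (λ { refl → eac , ¬eam }) a∈vs)
    ... | no m⊈c
      with d , d∈vs , ¬[edm⇒edc] ← find (¬All⇒Any¬ (λ d → E? d m →-dec E? d c) vs m⊈c)
      = d , d∈vs , decidable-stable (E? d m) (¬[edm⇒edc] ∘ flip contradiction) , ¬[edm⇒edc] ∘ const

  unvisited : List (Fin n) → ℕ
  unvisited vs = length (filter (_∉? vs) (allFin n))

  unvisited-visit : ∀ {m vs} → m ∉ vs → unvisited (m ∷ vs) < unvisited vs
  unvisited-visit {m} {vs} m∉vs =
    length-filter-< (_∉? (m ∷ vs)) (_∉? vs) (All.universal (λ _ → _∘ there) (allFin n))
      (Any.map (λ { refl → m∉vs , λ m∉m∷vs → m∉m∷vs (here refl) }) (∈-allFin m))

  extend-to-all : ∀ {vs} ws → MNSSearch (ws ++ vs) → Acc _<_ (unvisited (ws ++ vs)) →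
                  ∃ λ ws′ → MNSSearch (ws′ ++ vs) × (∀ v → v ∈ ws′ ++ vs)
  extend-to-all {vs} ws S (acc rec) with Fin.all? (_∈? (ws ++ vs))
  ... | yes all∈ = ws , S , all∈
  ... | no ¬all∈ with v , v∉ ← Fin.¬∀⟶∃¬ n _ (_∈? (ws ++ vs)) ¬all∈
                 with m , m∉ , _ , m-max ← choose (ws ++ vs) v∉
    = extend-to-all (m ∷ ws) (visit m∉ m-max S) (rec (unvisited-visit m∉))

  complete : ∀ {vs} → MNSSearch vs → ∃ λ ws → MNSSearch (ws ++ vs) × (∀ v → v ∈ ws ++ vs)
  complete {vs} S = extend-to-all [] S (<-wellFounded (unvisited vs))

  module SearchOrdering {vs} (S : MNSSearch vs) (all∈vs : ∀ v → v ∈ vs) where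
    open OrderingOf (≺-isStrictTotalOrder (search-unique S) all∈vs) public
      using (ordering; ≺⇒<σ; <σ⇒≺)

    ordering-isMNS : IsMNS G ordering
    ordering-isMNS a b c a<b b<c eac ¬eab
      with d , d≺b , edb , ¬edc ← search-mns S (<σ⇒≺ a<b) (inj₁ (<σ⇒≺ b<c)) eac ¬eab
      = d , ≺⇒<σ d≺b , edb , ¬edc

  module _ {x w y z : Fin n} (exw : E x w) (ewy : E w y) (exz : E x z) (¬exy : ¬ E x y) (¬ewz : ¬ E w z)
           (y≢x : ¬ y ≡ x) (z≢w : ¬ z ≡ w) where

    reach-non-neighbour : ∀ us → MNSSearch (us ++ [ x ]) →
                          w ∈ us ++ [ x ] → y ∉ us ++ [ x ] → z ∉ us ++ [ x ] →
                          Acc _<_ (unvisited (us ++ [ x ])) →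
                          ∃₂ λ m us′ → MNSSearch (m ∷ us′ ++ [ x ]) ×
                                       z ∉ m ∷ us′ ++ [ x ] × ¬ E x m
    reach-non-neighbour us S w∈ y∉ z∉ (acc rec)
      with m , m∉ , y⊆m , m-max ← choose (us ++ [ x ]) y∉ | E? x m
    ... | no ¬exm = m , us , visit m∉ m-max S , z∉m∷us , ¬exm
      where
      z∉m∷us : z ∉ m ∷ us ++ [ x ]
      z∉m∷us (here refl) = ¬exm exz
      z∉m∷us (there z∈)  = z∉ z∈
    ... | yes exm =
      reach-non-neighbour (m ∷ us) (visit m∉ m-max S) (there w∈) y∉m∷us z∉m∷us (rec (unvisited-visit m∉))
      where
      y∉m∷us : y ∉ m ∷ us ++ [ x ]
      y∉m∷us (here refl) = ¬exy exm
      y∉m∷us (there y∈)  = y∉ y∈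

      z∉m∷us : z ∉ m ∷ us ++ [ x ]
      z∉m∷us (here refl) = ¬ewz (All.lookup y⊆m w∈ ewy)
      z∉m∷us (there z∈)  = z∉ z∈

    start : MNSSearch (w ∷ [ x ])
    start = visit (λ { (here refl) → E-irrefl exw refl })
                  (λ { (here refl) _ _ ¬exw → contradiction exw ¬exw })
                  (visit (λ ()) (λ ()) [])

    y∉start : y ∉ w ∷ [ x ]
    y∉start (here refl)         = E-irrefl ewy refl
    y∉start (there (here refl)) = y≢x refl

    z∉start : z ∉ w ∷ [ x ]
    z∉start (here refl)         = z≢w refl
    z∉start (there (here refl)) = E-irrefl exz refl

    mns-not-lexBFS : ∃ λ σ → IsMNS G σ × ¬ IsLexBFS G σ
    mns-not-lexBFS
      with m , us , S₁ , z∉ , ¬exm ←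
             reach-non-neighbour [ w ] start (here refl) y∉start z∉start (<-wellFounded _)
      with ws , S , all∈ ← complete S₁
      = ordering , ordering-isMNS , not-lexBFS
      where
      open SearchOrdering S all∈

      x≺m : x ≺[ ws ++ m ∷ us ++ [ x ] ] m
      x≺m = ≺-++⁺ʳ ws (newest (∈-++⁺ʳ us (here refl)))

      m≺z : m ≺[ ws ++ m ∷ us ++ [ x ] ] z
      m≺z = ≺-++-new (here refl) ([ id , (λ z∈ → contradiction z∈ z∉) ]′ (∈-++⁻ ws (all∈ z)))

      nothing-before-x : ∀ {d} → ¬ d ≺[ ws ++ m ∷ us ++ [ x ] ] x
      nothing-before-x d≺x = ≺-[] (≺-++⁻ʳ (m ∷ us) (search-unique S₁) (here refl)
        (≺-++⁻ʳ ws (search-unique S) (∈-++⁺ʳ (m ∷ us) (here refl)) d≺x))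

      not-lexBFS : ¬ IsLexBFS G ordering
      not-lexBFS lexBFS with _ , d<x , _ ← lexBFS x m z (≺⇒<σ x≺m) (≺⇒<σ m≺z) exz ¬exm
        = nothing-before-x (<σ⇒≺ d<x)

theorem5 : {n : ℕ} (G : Graph n) → Connected G →
    ((σ : Ordering n) → IsMNS G σ → IsLexBFS G σ) →
    P4C4Free G
theorem5 G _ mns⇒lexBFS a b c d = no-P4 , no-C4
  where
  refute : (∃ λ σ → IsMNS G σ × ¬ IsLexBFS G σ) → ⊥
  refute (σ , mns , ¬lexBFS) = ¬lexBFS (mns⇒lexBFS σ mns)

  no-P4 : ¬ InducedP4 G a b c d
  no-P4 (_ , a≢c , _ , _ , b≢d , _ , eab , ebc , ecd , ¬eac , ¬ebd , _) =
    refute (mns-not-lexBFS G ebc ecd (E-sym G eab) ¬ebd (¬eac ∘ E-sym G) (b≢d ∘ sym) a≢c)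

  no-C4 : ¬ InducedC4 G a b c d
  no-C4 (_ , a≢c , _ , _ , b≢d , _ , eab , ebc , _ , eda , ¬eac , ¬ebd) =
    refute (mns-not-lexBFS G eab ebc (E-sym G eda) ¬eac ¬ebd (a≢c ∘ sym) (b≢d ∘ sym))
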